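{- Let $a\geqslant 2$ and $b\geqslant 0$ be integers. If $\pi\in\mathrm{Av}(\sigma_{a,b})$, then $S(\pi)\in\mathrm{Av}(\sigma_{a,b})$.
   Context: Permutations are written in one-line notation $\pi=\pi_1\ldots\pi_n$; $\mathfrak{S}_n$ is the set of permutations of size $n$. A permutation $\pi$ contains a pattern $\rho$ of size $k$ if some subsequence $\pi_{i_1}\ldots\pi_{i_k}$ ($i_1<\dots<i_k$) is order-isomorphic to $\rho$ (an occurrence); in it, $\pi_{i_j}$ plays the role of the value $\rho_j$. $\pi$ avoids $\rho$ if it does not contain it; $\mathrm{Av}(\Pi)$ is the set of all permutations avoiding every pattern in the set $\Pi$. $[x,y]$ is the set of integers between $x$ and $y$ inclusive; $\iota_k=12\ldots k$. For integers $c\geqslant1,d\geqslant0$ with $c+d\geqslant 2$, the partial shuffle $\Pi(c,d)$ is the set of permutations of size $c+d$ obtained by writing $[c+d]\setminus\{c\}$ in increasing order and inserting $c$ in every position except the one giving $\iota_{c+d}$. Fix $a\geqslant 2$, $b\geqslant 0$. $\sigma_{a,b}$ is the permutation obtained from $\iota_{a+b}$ by transposing the entries $a-1$ and $a$ (it is the unique element of $\Pi(a,b)\cap\Pi(a-1,b+1)$). If $\pi$ contains a pattern from $\Pi(a-1,b+1)$, $\underline{a}$ is the smallest value of an entry of $\pi$ playing the role of $a$ in some occurrence of a pattern from $\Pi(a-1,b+1)$; an entry is an $a-1$ element associated with $\underline{a}$ if it plays the role of $a-1$ in an occurrence of a pattern from $\Pi(a-1,b+1)$ in which the entry of value $\underline{a}$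 plays the role of $a$; $\underline{a-1}$ is the smallest value of such an entry. The map $S:\mathfrak{S}_n\to\mathfrak{S}_n$ (depending on $a,b$) is defined by: $S(\pi)=\pi$ if $\pi$ avoids every pattern of $\Pi(a-1,b+1)$; otherwise $S(\pi)_i=\pi_i+1$ if $\pi_i\in[\underline{a-1},\underline{a}-1]$, $S(\pi)_i=\underline{a-1}$ if $\pi_i=\underline{a}$, and $S(\pi)_i=\pi_i$ otherwise. -}

module Defs where

open import Data.Nat using (ℕ; zero; suc; _+_; _∸_; _≤_; _<_; _≤?_; _<?_; _≟_)
open import Data.Fin using (Fin; toℕ) renaming (_<_ to _<ᶠ_)
open import Data.Product using (Σ; Σ-syntax; ∃; ∃-syntax; _×_; _,_)
open import Data.Sum using (_⊎_)
open import Relation.Nullary using (¬_; yes; no)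
open import Relation.Binary.PropositionalEquality using (_≡_; _≢_)

-- A permutation of size n in one-line notation: π : Fin n → ℕ (values 1-based),
-- π is a bijection from the n positions onto [1, n].
IsPerm : (n : ℕ) → (Fin n → ℕ) → Set
IsPerm n π = (∀ i → 1 ≤ π i × π i ≤ n) × (∀ i j → π i ≡ π j → i ≡ j)

IsOccurrence : {k n : ℕ} → (Fin k → ℕ) → (Fin n → ℕ) → (Fin k → Fin n) → Set
IsOccurrence ρ π e =
  (∀ i j → i <ᶠ j → e i <ᶠ e j) ×
  (∀ i j → (ρ i < ρ j → π (e i) < π (e j)) × (π (e i) < π (e j) → ρ i < ρ j))

Contains : {k n : ℕ} → (Fin k → ℕ) → (Fin n → ℕ) → Set
Contains ρ π = ∃[ e ] IsOccurrence ρ π e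

Avoids : {k n : ℕ} → (Fin k → ℕ) → (Fin n → ℕ) → Set
Avoids ρ π = ¬ Contains ρ π

-- σ_{a,b}: identity of size a+b with the entries a-1 and a transposed.
-- Position j (0-based) holds j+1 in the identity.
σ : (a b : ℕ) → Fin (a + b) → ℕ
σ a b j with suc (toℕ j) ≟ a ∸ 1
... | yes _ = a
... | no _ with suc (toℕ j) ≟ a
...   | yes _ = a ∸ 1
...   | no _ = suc (toℕ j)

-- The r-th (0-based) element of [c+d] \ {c} in increasing order.
remElem : (c r : ℕ) → ℕ
remElem c r with suc r <? c
... | yes _ = suc r
... | no _ = suc (suc r)

-- insertPat c d p : the permutation of size c+d obtained by writing
-- [c+d] \ {c} in increasing order and inserting c so that it ends at
-- position p (0-based).
insertPat : (c d : ℕ) → Fin (c + d) → Fin (c + d) → ℕ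
insertPat c d p i with toℕ i ≟ toℕ p
... | yes _ = c
... | no _ with toℕ i <? toℕ p
...   | yes _ = remElem c (toℕ i)
...   | no _ = remElem c (toℕ i ∸ 1)

-- Π(c,d) = { insertPat c d p | p a position other than c-1 (0-based),
-- the only position giving the identity }.
InPartialShuffle : (c d : ℕ) → Fin (c + d) → Set
InPartialShuffle c d p = toℕ p ≢ c ∸ 1

AvoidsPartialShuffle : {n : ℕ} → (c d : ℕ) → (Fin n → ℕ) → Set
AvoidsPartialShuffle c d π =
  ∀ p → InPartialShuffle c d p → Avoids (insertPat c d p) π

RolePair : {n : ℕ} → (a b : ℕ) → (Fin n → ℕ) → ℕ → ℕ → Set
RolePair {n} a b π u w =
  Σ[ p ∈ Fin (a ∸ 1 + suc b) ] InPartialShuffle (a ∸ 1) (suc b) p ×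
  Σ[ e ∈ (Fin (a ∸ 1 + suc b) → Fin n) ]
    IsOccurrence (insertPat (a ∸ 1) (suc b) p) π e ×
  Σ[ j ∈ Fin (a ∸ 1 + suc b) ] Σ[ j' ∈ Fin (a ∸ 1 + suc b) ]
    insertPat (a ∸ 1) (suc b) p j ≡ a × insertPat (a ∸ 1) (suc b) p j' ≡ a ∸ 1 ×
    π (e j) ≡ u × π (e j') ≡ w

PlaysA : {n : ℕ} → (a b : ℕ) → (Fin n → ℕ) → ℕ → Set
PlaysA a b π u = ∃[ w ] RolePair a b π u w

IsLeast : (ℕ → Set) → ℕ → Set
IsLeast P m = P m × (∀ v → P v → m ≤ v)

-- the value transformation of S, given the values A = a̲ and A1 = (a-1)̲
shiftVal : (A A1 x : ℕ) → ℕ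
shiftVal A A1 x with A1 ≤? x | x <? A
... | yes _ | yes _ = suc x
... | _ | _ with x ≟ A
...   | yes _ = A1
...   | no _ = x

IsS : {n : ℕ} → (a b : ℕ) → (Fin n → ℕ) → (Fin n → ℕ) → Set
IsS a b π π' =
  (AvoidsPartialShuffle (a ∸ 1) (suc b) π × (∀ i → π' i ≡ π i)) ⊎
  (Σ[ A ∈ ℕ ] Σ[ A1 ∈ ℕ ]
     IsLeast (PlaysA a b π) A × IsLeast (RolePair a b π A) A1 ×
     (∀ i → π' i ≡ shiftVal A A1 (π i)))

-- Both σ_{a,b} and the patterns of Π(a-1,b+1) are an increasing base of a+b-1 entries with one
-- entry of value a-1 inserted at some index q: σ_{a,b} is q = a-1, and q = a-2 would give the identity.
-- Let x and y be the entries of π of values a̲ and (a-1)̲. On the values other than a̲ the map S is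
-- strictly increasing, so it preserves and reflects the relative order of all entries except x, and an
-- occurrence of σ_{a,b} in S(π) avoiding x is one in π. If the occurrence uses x, either as its
-- inserted entry or as a base entry, splice it with the tail, from x on, of an occurrence realising
-- (a̲, (a-1)̲). This gives an occurrence of σ_{a,b} in π, or a pattern of Π(a-1,b+1) whose a-entry is
-- below a̲, or one whose a-entry is x and whose (a-1)-entry is below (a-1)̲.

module Submission where

open import Defs
open import Data.Nat using (ℕ; zero; suc; _+_; pred; _≤_; _<_; _≤?_; _<?_; _≟_; z≤n; s≤s; >-nonZero)
open import Data.Nat.Properties
open import Data.Nat.DivMod using (_mod_; m<n⇒m%n≡m)
open import Data.Fin using (Fin; toℕ)
open import Data.Fin.Properties using (toℕ<n; toℕ-injective; toℕ-fromℕ<) renaming (_≟_ to _≟ᶠ_)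
open import Data.Product using (∃-syntax; _×_; _,_; proj₁; proj₂; uncurry)
open import Data.Sum using (_⊎_; inj₁; inj₂)
open import Data.Empty using (⊥; ⊥-elim)
open import Function using (_∘_; const)
open import Relation.Nullary using (¬_; yes; no)
open import Relation.Binary using (tri<; tri≈; tri>)
open import Relation.Binary.PropositionalEquality

-- Finite sequences are functions on ℕ of which only the indices in [lo, hi) matter.

Ascending : (ℕ → ℕ) → ℕ → ℕ → Set
Ascending f lo hi = ∀ {s t} → lo ≤ s → s < t → t < hi → f s < f t

record Splits (f : ℕ → ℕ) (lo hi q m : ℕ) : Set where
  field
    below : ∀ {t} → lo ≤ t → t < hi → t < q → f t < m
    above : ∀ {t} → lo ≤ t → t < hi → q ≤ t → m < f t

module _ {f : ℕ → ℕ} {lo hi : ℕ} where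

  Ascending⇒≤ : Ascending f lo hi → ∀ {s t} → lo ≤ s → s ≤ t → t < hi → f s ≤ f t
  Ascending⇒≤ asc lo≤s s≤t t<hi with m≤n⇒m<n∨m≡n s≤t
  ... | inj₁ s<t  = <⇒≤ (asc lo≤s s<t t<hi)
  ... | inj₂ refl = ≤-refl

  Ascending-reflects : Ascending f lo hi → ∀ {s t} → lo ≤ s → lo ≤ t → s < hi → t < hi → f s < f t → s < t
  Ascending-reflects asc {s} {t} lo≤s lo≤t s<hi t<hi fs<ft with <-cmp s t
  ... | tri< s<t _ _ = s<t
  ... | tri≈ _ refl _ = ⊥-elim (<-irrefl refl fs<ft)
  ... | tri> _ _ t<s = ⊥-elim (<-asym fs<ft (asc lo≤t t<s s<hi))

  Ascending-injective : Ascending f lo hi → ∀ {s t} → lo ≤ s → lo ≤ t → s < hi → t < hi → f s ≡ f t → s ≡ t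
  Ascending-injective asc {s} {t} lo≤s lo≤t s<hi t<hi fs≡ft with <-cmp s t
  ... | tri< s<t _ _ = ⊥-elim (<-irrefl fs≡ft (asc lo≤s s<t t<hi))
  ... | tri≈ _ s≡t _ = s≡t
  ... | tri> _ _ t<s = ⊥-elim (<-irrefl (sym fs≡ft) (asc lo≤t t<s s<hi))

  Ascending-⊆ : ∀ {lo′ hi′} → lo ≤ lo′ → hi′ ≤ hi → Ascending f lo hi → Ascending f lo′ hi′
  Ascending-⊆ lo≤lo′ hi′≤hi asc lo′≤s s<t t<hi′ = asc (≤-trans lo≤lo′ lo′≤s) s<t (<-≤-trans t<hi′ hi′≤hi)

  Splits-⊆ : ∀ {lo′ hi′ q m} → lo ≤ lo′ → hi′ ≤ hi → Splits f lo hi q m → Splits f lo′ hi′ q m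
  Splits-⊆ lo≤lo′ hi′≤hi sp = record
    { below = λ lo′≤t t<hi′ → Splits.below sp (≤-trans lo≤lo′ lo′≤t) (<-≤-trans t<hi′ hi′≤hi)
    ; above = λ lo′≤t t<hi′ → Splits.above sp (≤-trans lo≤lo′ lo′≤t) (<-≤-trans t<hi′ hi′≤hi) }

  Splits-index-> : ∀ {q m t} → Splits f lo hi q m → lo ≤ t → t < hi → f t < m → t < q
  Splits-index-> {q} {t = t} sp lo≤t t<hi ft<m with t <? q
  ... | yes t<q = t<q
  ... | no t≮q = ⊥-elim (<-asym ft<m (Splits.above sp lo≤t t<hi (≮⇒≥ t≮q)))

  Splits-index-≤ : ∀ {q m t} → Splits f lo hi q m → lo ≤ t → t < hi → m < f t → q ≤ t
  Splits-index-≤ {q} {t = t} sp lo≤t t<hi m<ft with t <? q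
  ... | yes t<q = ⊥-elim (<-asym m<ft (Splits.below sp lo≤t t<hi t<q))
  ... | no t≮q = ≮⇒≥ t≮q

Splits-below : ∀ {f lo hi q m} → hi ≤ q → (∀ {t} → lo ≤ t → t < hi → f t < m) → Splits f lo hi q m
Splits-below hi≤q f<m = record
  { below = λ lo≤t t<hi _ → f<m lo≤t t<hi
  ; above = λ _ t<hi q≤t → ⊥-elim (<⇒≱ t<hi (≤-trans hi≤q q≤t)) }

Splits-above : ∀ {f lo hi q m} → q ≤ lo → (∀ {t} → lo ≤ t → t < hi → m < f t) → Splits f lo hi q m
Splits-above q≤lo m<f = record
  { below = λ lo≤t _ t<q → ⊥-elim (<⇒≱ t<q (≤-trans q≤lo lo≤t))
  ; above = λ lo≤t t<hi _ → m<f lo≤t t<hi }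

Ascending-singleton : ∀ {f lo} → Ascending f lo (suc lo)
Ascending-singleton lo≤s s<t t<1+lo = ⊥-elim (<⇒≱ (<-≤-trans s<t (≤-pred t<1+lo)) lo≤s)

Ascending-pred : ∀ {f lo hi} → Ascending f lo hi → Ascending (f ∘ pred) (suc lo) (suc hi)
Ascending-pred asc (s≤s lo≤s) (s≤s s<t) (s≤s t<hi) = asc lo≤s (<-≤-trans (n<1+n _) s<t) t<hi

glue : {A : Set} → ℕ → (ℕ → A) → (ℕ → A) → ℕ → A
glue j U V s with s <? j
... | yes _ = U s
... | no _  = V s

module _ {A : Set} (g : A → ℕ) {U V : ℕ → A} {lo j hi : ℕ} where

  Ascending-glue : Ascending (g ∘ U) lo j → Ascending (g ∘ V) j hi →
                   (∀ {s t} → lo ≤ s → s < j → j ≤ t → t < hi → g (U s) < g (V t)) →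
                   Ascending (g ∘ glue j U V) lo hi
  Ascending-glue ascU ascV cross {s} {t} lo≤s s<t t<hi with s <? j | t <? j
  ... | yes s<j | yes t<j = ascU lo≤s s<t t<j
  ... | yes s<j | no t≮j  = cross lo≤s s<j (≮⇒≥ t≮j) t<hi
  ... | no s≮j  | yes t<j = ⊥-elim (s≮j (<-trans s<t t<j))
  ... | no s≮j  | no t≮j  = ascV (≮⇒≥ s≮j) s<t t<hi

  Splits-glue : ∀ {q m} → Splits (g ∘ U) lo j q m → Splits (g ∘ V) j hi q m →
                Splits (g ∘ glue j U V) lo hi q m
  Splits-glue {q} {m} spU spV = record { below = below ; above = above }
    where
      below : ∀ {t} → lo ≤ t → t < hi → t < q → g (glue j U V t) < m
      below {t} lo≤t t<hi t<q with t <? j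
      ... | yes t<j = Splits.below spU lo≤t t<j t<q
      ... | no t≮j  = Splits.below spV (≮⇒≥ t≮j) t<hi t<q
      above : ∀ {t} → lo ≤ t → t < hi → q ≤ t → m < g (glue j U V t)
      above {t} lo≤t t<hi q≤t with t <? j
      ... | yes t<j = Splits.above spU lo≤t t<j q≤t
      ... | no t≮j  = Splits.above spV (≮⇒≥ t≮j) t<hi q≤t

glue-< : {A : Set} {U V : ℕ → A} {j s : ℕ} → s < j → glue j U V s ≡ U s
glue-< {j = j} {s} s<j with s <? j
... | yes _   = refl
... | no s≮j  = ⊥-elim (s≮j s<j)

glue-≥ : {A : Set} {U V : ℕ → A} {j s : ℕ} → j ≤ s → glue j U V s ≡ V s
glue-≥ {j = j} {s} j≤s with s <? j
... | yes s<j = ⊥-elim (<⇒≱ s<j j≤s)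
... | no _    = refl

insertionPoint : ∀ {f m} L → Ascending f 0 L → (∀ {t} → t < L → f t ≢ m) →
                 ∃[ q ] q ≤ L × Splits f 0 L q m
insertionPoint zero asc f≢m = 0 , z≤n , record { below = λ _ () ; above = λ _ () }
insertionPoint {f} {m} (suc L) asc f≢m
  with insertionPoint L (Ascending-⊆ ≤-refl (n≤1+n L) asc) (f≢m ∘ m<n⇒m<1+n)
... | q , q≤L , sp with f L <? m
...   | yes fL<m = suc L , ≤-refl , Splits-below ≤-refl
      (λ z≤t t<1+L → ≤-<-trans (Ascending⇒≤ asc z≤t (<⇒≤pred t<1+L) (n<1+n L)) fL<m)
...   | no fL≮m = q , m≤n⇒m≤1+n q≤L , record { below = below ; above = above }
  where
    m<fL : m < f L
    m<fL = ≤∧≢⇒< (≮⇒≥ fL≮m) (≢-sym (f≢m (n<1+n L)))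
    below : ∀ {t} → 0 ≤ t → t < suc L → t < q → f t < m
    below z≤t t<1+L t<q = Splits.below sp z≤t (<-≤-trans t<q q≤L) t<q
    above : ∀ {t} → 0 ≤ t → t < suc L → q ≤ t → m < f t
    above z≤t t<1+L q≤t with m<1+n⇒m<n∨m≡n t<1+L
    ... | inj₁ t<L  = Splits.above sp z≤t t<L q≤t
    ... | inj₂ refl = m<fL

-- Inserting one entry into a sequence

data Slot (q : ℕ) : ℕ → Set where
  before   : ∀ {t} → t < q → Slot q t
  inserted : Slot q q
  after    : ∀ {t} → q ≤ t → Slot q (suc t)

slot : ∀ q i → Slot q i
slot q i with <-cmp i q
... | tri< i<q _ _ = before i<q
... | tri≈ _ refl _ = inserted
slot q (suc t) | tri> _ _ (s≤s q≤t) = after q≤t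

insert : {A : Set} → ℕ → A → (ℕ → A) → ℕ → A
insert q m F i with slot q i
... | before {t} _ = F t
... | inserted     = m
... | after {t} _  = F t

module _ {A : Set} {q : ℕ} {m : A} {F : ℕ → A} where

  insert-< : ∀ {i} → i < q → insert q m F i ≡ F i
  insert-< {i} i<q with slot q i
  ... | before _   = refl
  ... | inserted   = ⊥-elim (<-irrefl refl i<q)
  ... | after q≤t  = ⊥-elim (<⇒≱ i<q (m≤n⇒m≤1+n q≤t))

  insert-> : ∀ {i} → q < i → insert q m F i ≡ F (pred i)
  insert-> {i} q<i with slot q i
  ... | before i<q = ⊥-elim (<-asym i<q q<i)
  ... | inserted   = ⊥-elim (<-irrefl refl q<i)
  ... | after _    = refl

skip : ℕ → ℕ → ℕ
skip q t with t <? q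
... | yes _ = t
... | no _  = suc t

insert-skip : {A : Set} (q : ℕ) (m : A) (F : ℕ → A) (t : ℕ) → insert q m F (skip q t) ≡ F t
insert-skip q m F t with t <? q
... | yes t<q = insert-< t<q
... | no t≮q  = insert-> (s≤s (≮⇒≥ t≮q))

skip-< : ∀ {q t} → t < q → skip q t ≡ t
skip-< {q} {t} t<q with t <? q
... | yes _ = refl
... | no t≮q = ⊥-elim (t≮q t<q)

skip-≥ : ∀ {q t} → q ≤ t → skip q t ≡ suc t
skip-≥ {q} {t} q≤t with t <? q
... | yes t<q = ⊥-elim (<⇒≱ t<q q≤t)
... | no _ = refl

skip-≤ : ∀ q t → skip q t ≤ suc t
skip-≤ q t with t <? q
... | yes _ = n≤1+n t
... | no _  = ≤-refl

skip-ascending : ∀ q {lo hi} → Ascending (skip q) lo hi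
skip-ascending q {s = s} {t} _ s<t _ with s <? q | t <? q
... | yes _   | yes _   = s<t
... | yes _   | no _    = m<n⇒m<1+n s<t
... | no s≮q  | yes t<q = ⊥-elim (s≮q (<-trans s<t t<q))
... | no _    | no _    = s≤s s<t

skip-splits : ∀ q {lo hi} → Splits (skip q) lo hi q q
skip-splits q = record
  { below = λ {t} _ _ t<q → subst (_< q) (sym (skip-< t<q)) t<q
  ; above = λ {t} _ _ q≤t → subst (q <_) (sym (skip-≥ q≤t)) (s≤s q≤t) }

skip-insert : {A : Set} (q : ℕ) (U : ℕ → A) (i : ℕ) → insert q (U q) (U ∘ skip q) i ≡ U i
skip-insert q U i with slot q i
... | before t<q = cong U (skip-< t<q)
... | inserted   = refl
... | after q≤t  = cong U (skip-≥ q≤t)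

insert-at : {A : Set} (q : ℕ) (m : A) (F : ℕ → A) → insert q m F q ≡ m
insert-at q m F with slot q q
... | before q<q = ⊥-elim (<-irrefl refl q<q)
... | inserted   = refl
... | after q≤t  = ⊥-elim (<-irrefl refl q≤t)

insert-≡ : {A : Set} {q : ℕ} {m : A} {F : ℕ → A} {i : ℕ} → i ≡ q → insert q m F i ≡ m
insert-≡ {q = q} {m} {F} refl = insert-at q m F

insert-map : {A B : Set} (g : A → B) (q : ℕ) (m : A) (F : ℕ → A) (i : ℕ) →
             g (insert q m F i) ≡ insert q (g m) (g ∘ F) i
insert-map g q m F i with slot q i
... | before _ = refl
... | inserted = refl
... | after _  = refl

OrderPreserving : (ℕ → ℕ) → (ℕ → ℕ) → ℕ → Set
OrderPreserving F G N = ∀ {i j} → i < N → j < N → F i < F j → G i < G j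

Ascending⇒OrderPreserving : ∀ {F G L} → Ascending F 0 L → Ascending G 0 L → OrderPreserving F G L
Ascending⇒OrderPreserving ascF ascG i<L j<L Fi<Fj =
  ascG z≤n (Ascending-reflects ascF z≤n z≤n i<L j<L Fi<Fj) j<L

module _ {F G : ℕ → ℕ} {L k m m′ : ℕ} (pres : OrderPreserving F G L)
         (spF : Splits F 0 L k m) (spG : Splits G 0 L k m′) where

  private
    below : ∀ {t} → t < L → F t < m → G t < m′
    below t<L Ft<m = Splits.below spG z≤n t<L (Splits-index-> spF z≤n t<L Ft<m)

    above : ∀ {t} → t < L → m < F t → m′ < G t
    above t<L m<Ft = Splits.above spG z≤n t<L (Splits-index-≤ spF z≤n t<L m<Ft)

  OrderPreserving-insert : ∀ {q} → q ≤ L → OrderPreserving (insert q m F) (insert q m′ G) (suc L)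
  OrderPreserving-insert {q} q≤L {i} {j} i<1+L j<1+L with slot q i | slot q j
  ... | before s<q | before t<q = pres (<-≤-trans s<q q≤L) (<-≤-trans t<q q≤L)
  ... | before s<q | inserted   = below (<-≤-trans s<q q≤L)
  ... | before s<q | after _    = pres (<-≤-trans s<q q≤L) (≤-pred j<1+L)
  ... | inserted   | before t<q = above (<-≤-trans t<q q≤L)
  ... | inserted   | inserted   = λ m<m → ⊥-elim (<-irrefl refl m<m)
  ... | inserted   | after _    = above (≤-pred j<1+L)
  ... | after _    | before t<q = pres (≤-pred i<1+L) (<-≤-trans t<q q≤L)
  ... | after _    | inserted   = below (≤-pred i<1+L)
  ... | after _    | after _    = pres (≤-pred i<1+L) (≤-pred j<1+L)

OrderPreserving-≗ : ∀ {F F′ G G′ N} → (∀ i → F i ≡ F′ i) → (∀ i → G i ≡ G′ i) →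
                    OrderPreserving F G N → OrderPreserving F′ G′ N
OrderPreserving-≗ {F} {F′} {G} {G′} F≗ G≗ pres {i} {j} i<N j<N F′i<F′j =
  subst₂ _<_ (G≗ i) (G≗ j) (pres i<N j<N (subst₂ _<_ (sym (F≗ i)) (sym (F≗ j)) F′i<F′j))

OrderPreserving⇒Ascending : ∀ {F G L} → Ascending F 0 L → OrderPreserving F G L → Ascending G 0 L
OrderPreserving⇒Ascending ascF pres z≤s s<t t<L = pres (<-trans s<t t<L) t<L (ascF z≤s s<t t<L)

-- insert q q (skip q) is the identity, so positions are handled by the same lemmas as values.
Ascending⇒insert-skip-preserving : ∀ {G N} q → Ascending G 0 N → OrderPreserving (insert q q (skip q)) G N
Ascending⇒insert-skip-preserving q asc {i} {j} i<N j<N lt =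
  asc z≤n (subst₂ _<_ (skip-insert q (λ i → i) i) (skip-insert q (λ i → i) j) lt) j<N

module _ {G R : ℕ → ℕ} {L q c : ℕ} (pres : OrderPreserving (insert q c R) G (suc L)) where

  private
    skip<1+L : ∀ {t} → t < L → skip q t < suc L
    skip<1+L {t} t<L = ≤-<-trans (skip-≤ q t) (s≤s t<L)

  OrderPreserving-skip : OrderPreserving R (G ∘ skip q) L
  OrderPreserving-skip {s} {t} s<L t<L Rs<Rt = pres (skip<1+L s<L) (skip<1+L t<L)
    (subst₂ _<_ (sym (insert-skip q c R s)) (sym (insert-skip q c R t)) Rs<Rt)

  Splits-skip : ∀ {k} → q ≤ L → Splits R 0 L k c → Splits (G ∘ skip q) 0 L k (G q)
  Splits-skip q≤L sp = record
    { below = λ {t} z≤t t<L t<k → pres (skip<1+L t<L) (s≤s q≤L)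
        (subst₂ _<_ (sym (insert-skip q c R t)) (sym (insert-at q c R)) (Splits.below sp z≤t t<L t<k))
    ; above = λ {t} z≤t t<L k≤t → pres (s≤s q≤L) (skip<1+L t<L)
        (subst₂ _<_ (sym (insert-at q c R)) (sym (insert-skip q c R t)) (Splits.above sp z≤t t<L k≤t)) }

-- Occurrences of partial-shuffle patterns

remElem-ascending : ∀ c {lo hi} → Ascending (remElem c) lo hi
remElem-ascending c {s = s} {t} _ s<t _ with suc s <? c | suc t <? c
... | yes _   | yes _   = s≤s s<t
... | yes _   | no _    = s≤s (m<n⇒m<1+n s<t)
... | no 1+s≮c | yes 1+t<c = ⊥-elim (1+s≮c (<-trans (s≤s s<t) 1+t<c))
... | no _    | no _    = s≤s (s≤s s<t)

remElem-< : ∀ {k t} → t < k → remElem (suc k) t ≡ suc t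
remElem-< {k} {t} t<k with suc t <? suc k
... | yes _ = refl
... | no 1+t≮1+k = ⊥-elim (1+t≮1+k (s≤s t<k))

remElem-≥ : ∀ {k t} → k ≤ t → remElem (suc k) t ≡ suc (suc t)
remElem-≥ {k} {t} k≤t with suc t <? suc k
... | yes 1+t<1+k = ⊥-elim (<⇒≱ 1+t<1+k (s≤s k≤t))
... | no _ = refl

remElem-splits : ∀ k {lo hi} → Splits (remElem (suc k)) lo hi k (suc k)
remElem-splits k = record
  { below = λ _ _ t<k → subst (_< suc k) (sym (remElem-< t<k)) (s≤s t<k)
  ; above = λ _ _ k≤t → subst (suc k <_) (sym (remElem-≥ k≤t)) (s≤s (s≤s k≤t)) }

shufflePattern : ℕ → ℕ → ℕ → ℕ
shufflePattern k q = insert q (suc k) (remElem (suc k))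

-- An occurrence of shufflePattern k q, the pattern of Π(k+1, L-k) with k+1 at index q, in which
-- B k plays k+2 and w plays k+1; q = k+1 gives σ_{k+2, L-k-1}, and q = k would give the identity.
record Shuffled {n : ℕ} (π : Fin n → ℕ) (k L q : ℕ) (B : ℕ → Fin n) (w : Fin n) : Set where
  field
    q≤L       : q ≤ L
    pos-asc   : Ascending (toℕ ∘ B) 0 L
    val-asc   : Ascending (π ∘ B) 0 L
    pos-split : Splits (toℕ ∘ B) 0 L q (toℕ w)
    val-split : Splits (π ∘ B) 0 L k (π w)

  base≢inserted : ∀ {t} → t < L → B t ≢ w
  base≢inserted {t} t<L Bt≡w with t <? q
  ... | yes t<q = <-irrefl (cong toℕ Bt≡w) (Splits.below pos-split z≤n t<L t<q)
  ... | no t≮q  = <-irrefl (cong toℕ (sym Bt≡w)) (Splits.above pos-split z≤n t<L (≮⇒≥ t≮q))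

  base-injective : ∀ {s t} → s < L → t < L → B s ≡ B t → s ≡ t
  base-injective s<L t<L Bs≡Bt = Ascending-injective pos-asc z≤n z≤n s<L t<L (cong toℕ Bs≡Bt)

module _ {n : ℕ} {π : Fin n → ℕ} {k L q : ℕ} {B : ℕ → Fin n} {w : Fin n} (S : Shuffled π k L q B w) where
  open Shuffled S

  private
    positions : Ascending (toℕ ∘ insert q w B) 0 (suc L)
    positions = OrderPreserving⇒Ascending {F = λ i → i} (λ _ s<t _ → s<t)
      (OrderPreserving-≗ (skip-insert q (λ i → i)) (sym ∘ insert-map toℕ q w B)
        (OrderPreserving-insert (Ascending⇒OrderPreserving (skip-ascending q) pos-asc)
                                (skip-splits q) pos-split q≤L))

    values→ : OrderPreserving (shufflePattern k q) (π ∘ insert q w B) (suc L)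
    values→ = OrderPreserving-≗ (λ _ → refl) (sym ∘ insert-map π q w B)
      (OrderPreserving-insert (Ascending⇒OrderPreserving (remElem-ascending (suc k)) val-asc)
                              (remElem-splits k) val-split q≤L)

    values← : OrderPreserving (π ∘ insert q w B) (shufflePattern k q) (suc L)
    values← = OrderPreserving-≗ (sym ∘ insert-map π q w B) (λ _ → refl)
      (OrderPreserving-insert (Ascending⇒OrderPreserving val-asc (remElem-ascending (suc k)))
                              val-split (remElem-splits k) q≤L)

  Shuffled⇒IsOccurrence : ∀ {m} → m ≡ L → (ρ : Fin (suc m) → ℕ) →
                          (∀ i → ρ i ≡ shufflePattern k q (toℕ i)) →
                          IsOccurrence ρ π (insert q w B ∘ toℕ)
  Shuffled⇒IsOccurrence refl ρ ρ≡ =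
    (λ i j i<j → positions z≤n i<j (toℕ<n j)) ,
    λ i j → (λ ρi<ρj → values→ (toℕ<n i) (toℕ<n j) (subst₂ _<_ (ρ≡ i) (ρ≡ j) ρi<ρj)) ,
            (λ πi<πj → subst₂ _<_ (sym (ρ≡ i)) (sym (ρ≡ j)) (values← (toℕ<n i) (toℕ<n j) πi<πj))

toℕ-mod : ∀ {m t} → t < suc m → toℕ (t mod suc m) ≡ t
toℕ-mod t<1+m = trans (toℕ-fromℕ< _) (m<n⇒m%n≡m t<1+m)

-- Only indices t ≤ m are used, for which t mod suc m = t.
entryAt : ∀ {n m} → (Fin (suc m) → Fin n) → ℕ → Fin n
entryAt {m = m} e t = e (t mod suc m)

module _ {n m : ℕ} {π : Fin n → ℕ} {ρ : Fin (suc m) → ℕ} {e : Fin (suc m) → Fin n}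
         (occ : IsOccurrence ρ π e) where

  private
    E : ℕ → Fin n
    E = entryAt e

    positions : Ascending (toℕ ∘ E) 0 (suc m)
    positions {s} {t} _ s<t t<1+m =
      proj₁ occ (s mod suc m) (t mod suc m)
        (subst₂ _<_ (sym (toℕ-mod (<-trans s<t t<1+m))) (sym (toℕ-mod t<1+m)) s<t)

    values : ∀ {P} → (∀ i → ρ i ≡ P (toℕ i)) → OrderPreserving P (π ∘ E) (suc m)
    values {P} ρ≡ {s} {t} s<1+m t<1+m Ps<Pt =
      proj₁ (proj₂ occ (s mod suc m) (t mod suc m))
        (subst₂ _<_ (trans (cong P (sym (toℕ-mod s<1+m))) (sym (ρ≡ _)))
                    (trans (cong P (sym (toℕ-mod t<1+m))) (sym (ρ≡ _))) Ps<Pt)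

  IsOccurrence⇒Shuffled : ∀ {k L q} → m ≡ L → q ≤ L → (∀ i → ρ i ≡ shufflePattern k q (toℕ i)) →
                          Shuffled π k L q (entryAt e ∘ skip q) (entryAt e q)
  IsOccurrence⇒Shuffled {k} {q = q} refl q≤L ρ≡ = record
    { q≤L       = q≤L
    ; pos-asc   = OrderPreserving⇒Ascending (skip-ascending q) (OrderPreserving-skip pos-pres)
    ; val-asc   = OrderPreserving⇒Ascending (remElem-ascending (suc k)) (OrderPreserving-skip (values ρ≡))
    ; pos-split = Splits-skip pos-pres q≤L (skip-splits q)
    ; val-split = Splits-skip (values ρ≡) q≤L (remElem-splits k) }
    where
      pos-pres : OrderPreserving (insert q q (skip q)) (toℕ ∘ E) (suc m)
      pos-pres = Ascending⇒insert-skip-preserving q positions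

-- The right-hand side enters through its defining equations: a `with` on toℕ i ≟ toℕ p would also
-- abstract the comparisons inside `insert`.
insertPat≡ : ∀ c d p i → insertPat c d p i ≡ insert (toℕ p) c (remElem c) (toℕ i)
insertPat≡ c d p i = go (insert-≡ {m = c} {remElem c}) (insert-<) (insert->)
  where
    go : ∀ {r} → (toℕ i ≡ toℕ p → r ≡ c) → (toℕ i < toℕ p → r ≡ remElem c (toℕ i)) →
         (toℕ p < toℕ i → r ≡ remElem c (pred (toℕ i))) → insertPat c d p i ≡ r
    go eq lt gt with toℕ i ≟ toℕ p
    ... | yes i≡p = sym (eq i≡p)
    ... | no i≢p with toℕ i <? toℕ p
    ...   | yes i<p = sym (lt i<p)
    ...   | no i≮p  = sym (gt (≤∧≢⇒< (≮⇒≥ i≮p) (≢-sym i≢p)))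

σ≡ : ∀ k b j → σ (suc (suc k)) b j ≡ shufflePattern k (suc k) (toℕ j)
σ≡ k b j = go insert-≡ insert-< insert->
  where
    go : ∀ {r} → (toℕ j ≡ suc k → r ≡ suc k) → (toℕ j < suc k → r ≡ remElem (suc k) (toℕ j)) →
         (suc k < toℕ j → r ≡ remElem (suc k) (pred (toℕ j))) → σ (suc (suc k)) b j ≡ r
    go eq lt gt with suc (toℕ j) ≟ suc k
    ... | yes 1+j≡1+k = sym (trans (lt (s≤s (≤-reflexive j≡k)))
                                   (trans (remElem-≥ (≤-reflexive (sym j≡k))) (cong (suc ∘ suc) j≡k)))
      where j≡k = suc-injective 1+j≡1+k
    ... | no 1+j≢1+k with suc (toℕ j) ≟ suc (suc k)
    ...   | yes 1+j≡2+k = sym (eq (suc-injective 1+j≡2+k))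
    ...   | no 1+j≢2+k with <-cmp (toℕ j) (suc k)
    ...     | tri< j<1+k _ _ = sym (trans (lt j<1+k) (remElem-< (≤∧≢⇒< (≤-pred j<1+k) (1+j≢1+k ∘ cong suc))))
    ...     | tri≈ _ j≡1+k _ = ⊥-elim (1+j≢2+k (cong suc j≡1+k))
    ...     | tri> _ _ 1+k<j = sym (trans (gt 1+k<j)
                                   (trans (remElem-≥ (≤-trans (n≤1+n k) (<⇒≤pred 1+k<j)))
                                          (cong suc (suc-pred (toℕ j) {{>-nonZero (≤-<-trans z≤n 1+k<j)}}))))

-- The value map of S

data ShiftView (A A1 u : ℕ) : ℕ → Set where
  shifted : A1 ≤ u → u < A → ShiftView A A1 u (suc u)
  low     : u < A1 → ShiftView A A1 u u
  high    : A < u → ShiftView A A1 u u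

shiftView : ∀ A A1 u → u ≢ A → ShiftView A A1 u (shiftVal A A1 u)
shiftView A A1 u u≢A with A1 ≤? u | u <? A
... | yes A1≤u | yes u<A = shifted A1≤u u<A
... | yes _    | no u≮A with u ≟ A
...   | yes u≡A = ⊥-elim (u≢A u≡A)
...   | no _    = high (≤∧≢⇒< (≮⇒≥ u≮A) (≢-sym u≢A))
shiftView A A1 u u≢A | no A1≰u | _ with u ≟ A
...   | yes u≡A = ⊥-elim (u≢A u≡A)
...   | no _    = low (≰⇒> A1≰u)

shiftVal-A : ∀ A A1 → shiftVal A A1 A ≡ A1
shiftVal-A A A1 with A1 ≤? A | A <? A
... | yes _ | yes A<A = ⊥-elim (<-irrefl refl A<A)
... | yes _ | no _ with A ≟ A
...   | yes _ = refl
...   | no A≢A = ⊥-elim (A≢A refl)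
shiftVal-A A A1 | no _ | _ with A ≟ A
...   | yes _ = refl
...   | no A≢A = ⊥-elim (A≢A refl)

module _ {A A1 : ℕ} where

  shiftVal-<A1 : ∀ {u} → shiftVal A A1 u < A1 → u < A1
  shiftVal-<A1 {u} fu<A1 with u ≟ A
  ... | yes refl = ⊥-elim (<-irrefl (shiftVal-A A A1) fu<A1)
  ... | no u≢A with shiftVal A A1 u | shiftView A A1 u u≢A
  ...   | ._ | shifted A1≤u _ = ⊥-elim (<⇒≱ fu<A1 (m≤n⇒m≤1+n A1≤u))
  ...   | ._ | low u<A1       = u<A1
  ...   | ._ | high _         = fu<A1

  shiftVal->A1 : ∀ {u} → u ≢ A → A1 < shiftVal A A1 u → A1 ≤ u
  shiftVal->A1 {u} u≢A A1<fu with shiftVal A A1 u | shiftView A A1 u u≢A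
  ... | ._ | shifted A1≤u _ = A1≤u
  ... | ._ | low u<A1       = ⊥-elim (<-asym u<A1 A1<fu)
  ... | ._ | high _         = <⇒≤ A1<fu

  shiftVal-reflects-< : A1 < A → ∀ {u v} → u ≢ A → v ≢ A → shiftVal A A1 u < shiftVal A A1 v → u < v
  shiftVal-reflects-< A1<A {u} {v} u≢A v≢A fu<fv
    with shiftVal A A1 u | shiftView A A1 u u≢A | shiftVal A A1 v | shiftView A A1 v v≢A
  ... | ._ | shifted _ _    | ._ | shifted _ _    = ≤-pred fu<fv
  ... | ._ | shifted A1≤u _ | ._ | low v<A1       = ⊥-elim (<-asym (<-trans fu<fv v<A1) (s≤s A1≤u))
  ... | ._ | shifted _ u<A  | ._ | high A<v       = <-trans u<A A<v
  ... | ._ | low u<A1       | ._ | shifted A1≤v _ = <-≤-trans u<A1 A1≤v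
  ... | ._ | low _          | ._ | low _          = fu<fv
  ... | ._ | low u<A1       | ._ | high A<v       = <-trans (<-trans u<A1 A1<A) A<v
  ... | ._ | high A<u       | ._ | shifted _ v<A  = ⊥-elim (<⇒≱ (<-trans v<A A<u) (≤-pred fu<fv))
  ... | ._ | high _         | ._ | low _          = fu<fv
  ... | ._ | high _         | ._ | high _         = fu<fv

-- Here a = k+2, A = a̲ and A1 = (a-1)̲ are realised by W with x = M k and y, and π′ is S(π).
module ShiftAvoidsσ
  {n : ℕ} (π : Fin n → ℕ) (π-injective : ∀ {u v} → π u ≡ π v → u ≡ v)
  (k L : ℕ) (k<L : k < L)
  (σ-free : ∀ {B w} → ¬ Shuffled π k L (suc k) B w)
  (A A1 : ℕ)
  (A-least : ∀ {q B w} → q ≢ k → Shuffled π k L q B w → A ≤ π (B k))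
  (A1-least : ∀ {q B w} → q ≢ k → Shuffled π k L q B w → π (B k) ≡ A → A1 ≤ π w)
  {qᵐ : ℕ} {M : ℕ → Fin n} {y : Fin n}
  (qᵐ≢k : qᵐ ≢ k) (W : Shuffled π k L qᵐ M y) (πx≡A : π (M k) ≡ A) (πy≡A1 : π y ≡ A1)
  where

  private module W = Shuffled W

  x : Fin n
  x = M k

  A1<A : A1 < A
  A1<A = subst₂ _<_ πy≡A1 πx≡A (Splits.above W.val-split z≤n k<L ≤-refl)

  M<A1 : ∀ {t} → t < k → π (M t) < A1
  M<A1 t<k = subst (π (M _) <_) πy≡A1 (Splits.below W.val-split z≤n (<-trans t<k k<L) t<k)

  A≤M : ∀ {t} → k ≤ t → t < L → A ≤ π (M t)
  A≤M k≤t t<L = subst (_≤ π (M _)) πx≡A (Ascending⇒≤ W.val-asc z≤n k≤t t<L)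

  M<x : ∀ {t} → t < k → toℕ (M t) < toℕ x
  M<x t<k = W.pos-asc z≤n t<k k<L

  x≤M : ∀ {t} → k ≤ t → t < L → toℕ x ≤ toℕ (M t)
  x≤M = Ascending⇒≤ W.pos-asc z≤n

  -- C 0, …, C k followed by M k, M (k+1), … (with w at index k+1) has a-entry C k below a̲.
  low-prefix-impossible : ∀ {C w} →
    Ascending (toℕ ∘ C) 0 (suc k) → Ascending (π ∘ C) 0 (suc k) →
    (∀ {s} → s < suc k → toℕ (C s) < toℕ w) → toℕ w < toℕ x →
    (∀ {s} → s < k → π (C s) < π w) → π w < π (C k) → π (C k) < A → ⊥
  low-prefix-impossible {C} {w} C-pos-asc C-val-asc C<w w<x C<πw πw<Ck Ck<A =
    <⇒≱ Ck<A (subst (λ b → A ≤ π b) (glue-< (n<1+n k)) (A-least 1+k≢k S))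
    where
      1+k≢k : suc k ≢ k
      1+k≢k 1+k≡k = <-irrefl (sym 1+k≡k) (n<1+n k)
      tail : ∀ {t} → suc k ≤ t → t < L → k ≤ pred t × pred t < L
      tail 1+k≤t t<L = <⇒≤pred 1+k≤t , ≤-<-trans pred[n]≤n t<L
      C≤Ck : ∀ {s} → s < suc k → π (C s) ≤ π (C k)
      C≤Ck s<1+k = Ascending⇒≤ C-val-asc z≤n (≤-pred s<1+k) (n<1+n k)
      w<M : ∀ {t} → suc k ≤ t → t < L → toℕ w < toℕ (M (pred t))
      w<M 1+k≤t t<L = <-≤-trans w<x (uncurry x≤M (tail 1+k≤t t<L))
      A≤M′ : ∀ {t} → suc k ≤ t → t < L → A ≤ π (M (pred t))
      A≤M′ 1+k≤t t<L = uncurry A≤M (tail 1+k≤t t<L)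
      S : Shuffled π k L (suc k) (glue (suc k) C (M ∘ pred)) w
      S = record
        { q≤L       = k<L
        ; pos-asc   = Ascending-glue toℕ C-pos-asc
                        (Ascending-⊆ (s≤s z≤n) (n≤1+n L) (Ascending-pred W.pos-asc))
                        (λ _ s<1+k 1+k≤t t<L → <-trans (C<w s<1+k) (w<M 1+k≤t t<L))
        ; val-asc   = Ascending-glue π C-val-asc
                        (Ascending-⊆ (s≤s z≤n) (n≤1+n L) (Ascending-pred W.val-asc))
                        (λ _ s<1+k 1+k≤t t<L → <-≤-trans (≤-<-trans (C≤Ck s<1+k) Ck<A) (A≤M′ 1+k≤t t<L))
        ; pos-split = Splits-glue toℕ (Splits-below ≤-refl (λ _ → C<w)) (Splits-above ≤-refl w<M)
        ; val-split = Splits-glue π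
            (record { below = λ _ _ → C<πw
                    ; above = λ _ t<1+k k≤t → subst (λ t → π w < π (C t)) (≤-antisym k≤t (≤-pred t<1+k)) πw<Ck })
            (Splits-above (n≤1+n k) (λ 1+k≤t t<L → <-≤-trans (<-trans πw<Ck Ck<A) (A≤M′ 1+k≤t t<L))) }

  -- C 0, …, C (k-1) followed by x = M k, M (k+1), …, with w inserted, has a-entry x and (a-1)-entry
  -- w below (a-1)̲; the last hypothesis excludes the insertion index k.
  low-inserted-impossible : ∀ {C w} →
    Ascending (toℕ ∘ C) 0 k → Ascending (π ∘ C) 0 k →
    (∀ {s} → s < k → toℕ (C s) < toℕ x) → (∀ {s} → s < k → π (C s) < π w) →
    (∀ {s} → s < k → C s ≢ w) → π w < A1 →
    toℕ x < toℕ w ⊎ (∃[ j ] suc j ≡ k × toℕ w < toℕ (C j)) → ⊥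
  low-inserted-impossible {C} {w} C-pos-asc C-val-asc C<x C<πw C≢w πw<A1 not-between =
    from-insertion (insertionPoint L B-pos-asc B≢w)
    where
      B : ℕ → Fin n
      B = glue k C M
      Bk≡x : B k ≡ x
      Bk≡x = glue-≥ {U = C} {V = M} ≤-refl
      πw<M : ∀ {t} → k ≤ t → t < L → π w < π (M t)
      πw<M k≤t t<L = <-≤-trans (<-trans πw<A1 A1<A) (A≤M k≤t t<L)
      B-pos-asc : Ascending (toℕ ∘ B) 0 L
      B-pos-asc = Ascending-glue toℕ C-pos-asc (Ascending-⊆ z≤n ≤-refl W.pos-asc)
                    (λ _ s<k k≤t t<L → <-≤-trans (C<x s<k) (x≤M k≤t t<L))
      B≢w : ∀ {t} → t < L → toℕ (B t) ≢ toℕ w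
      B≢w {t} t<L Bt≡w with t <? k
      ... | yes t<k = C≢w t<k (toℕ-injective Bt≡w)
      ... | no t≮k  = <-irrefl (cong π (sym (toℕ-injective Bt≡w))) (πw<M (≮⇒≥ t≮k) t<L)
      q≢k : ∀ {q} → toℕ x < toℕ w ⊎ (∃[ j ] suc j ≡ k × toℕ w < toℕ (C j)) →
            Splits (toℕ ∘ B) 0 L q (toℕ w) → q ≢ k
      q≢k (inj₁ x<w) pos-split q≡k = <-irrefl (sym q≡k)
              (Splits-index-> pos-split z≤n k<L (subst (λ b → toℕ b < toℕ w) (sym Bk≡x) x<w))
      q≢k (inj₂ (j , 1+j≡k , w<Cj)) pos-split q≡k = <-irrefl (trans q≡k (sym 1+j≡k))
              (s≤s (Splits-index-≤ pos-split z≤n (<-trans j<k k<L)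
                     (subst (λ b → toℕ w < toℕ b) (sym (glue-< {U = C} {V = M} j<k)) w<Cj)))
        where j<k = subst (j <_) 1+j≡k (n<1+n j)
      from-insertion : ∃[ q ] q ≤ L × Splits (toℕ ∘ B) 0 L q (toℕ w) → ⊥
      from-insertion (q , q≤L , pos-split) =
        <⇒≱ πw<A1 (A1-least (q≢k not-between pos-split) S (trans (cong π Bk≡x) πx≡A))
        where
          S : Shuffled π k L q B w
          S = record
            { q≤L       = q≤L
            ; pos-asc   = B-pos-asc
            ; val-asc   = Ascending-glue π C-val-asc (Ascending-⊆ z≤n ≤-refl W.val-asc)
                            (λ _ s<k k≤t t<L → <-trans (C<πw s<k) (πw<M k≤t t<L))
            ; pos-split = pos-split
            ; val-split = Splits-glue π (Splits-below ≤-refl (λ _ → C<πw)) (Splits-above ≤-refl πw<M) }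

  π′ : Fin n → ℕ
  π′ = shiftVal A A1 ∘ π

  π′x≡A1 : π′ x ≡ A1
  π′x≡A1 = trans (cong (shiftVal A A1) πx≡A) (shiftVal-A A A1)

  π≢A : ∀ {u} → u ≢ x → π u ≢ A
  π≢A u≢x πu≡A = u≢x (π-injective (trans πu≡A (sym πx≡A)))

  π-reflects : ∀ {u v} → u ≢ x → v ≢ x → π′ u < π′ v → π u < π v
  π-reflects u≢x v≢x = shiftVal-reflects-< A1<A (π≢A u≢x) (π≢A v≢x)

  π<A1 : ∀ {u} → π′ u < π′ x → π u < A1
  π<A1 lt = shiftVal-<A1 (subst (_ <_) π′x≡A1 lt)

  A1≤π : ∀ {u} → u ≢ x → π′ x < π′ u → A1 ≤ π u
  A1≤π u≢x lt = shiftVal->A1 (π≢A u≢x) (subst (_< _) π′x≡A1 lt)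

  module _ {B : ℕ → Fin n} {lo hi : ℕ} (B≢x : ∀ {t} → lo ≤ t → t < hi → B t ≢ x) where

    Ascending-reflect : Ascending (π′ ∘ B) lo hi → Ascending (π ∘ B) lo hi
    Ascending-reflect asc lo≤s s<t t<hi =
      π-reflects (B≢x lo≤s (<-trans s<t t<hi)) (B≢x (≤-trans lo≤s (<⇒≤ s<t)) t<hi) (asc lo≤s s<t t<hi)

    Splits-reflect : ∀ {q w} → w ≢ x → Splits (π′ ∘ B) lo hi q (π′ w) → Splits (π ∘ B) lo hi q (π w)
    Splits-reflect w≢x sp = record
      { below = λ lo≤t t<hi t<q → π-reflects (B≢x lo≤t t<hi) w≢x (Splits.below sp lo≤t t<hi t<q)
      ; above = λ lo≤t t<hi q≤t → π-reflects w≢x (B≢x lo≤t t<hi) (Splits.above sp lo≤t t<hi q≤t) }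

  Shuffled-reflect : ∀ {q B w} → (∀ {t} → t < L → B t ≢ x) → w ≢ x →
                     Shuffled π′ k L q B w → Shuffled π k L q B w
  Shuffled-reflect B≢x w≢x S = record
    { q≤L = q≤L ; pos-asc = pos-asc ; pos-split = pos-split
    ; val-asc = Ascending-reflect (λ _ → B≢x) val-asc
    ; val-split = Splits-reflect (λ _ → B≢x) w≢x val-split }
    where open Shuffled S

  module XInserted {BO : ℕ → Fin n} (O : Shuffled π′ k L (suc k) BO x) where

    private module O = Shuffled O

    z : Fin n
    z = BO k

    BO-val-asc : Ascending (π ∘ BO) 0 L
    BO-val-asc = Ascending-reflect (λ _ → O.base≢inserted) O.val-asc

    BO<A1 : ∀ {t} → t < k → π (BO t) < A1
    BO<A1 t<k = π<A1 (Splits.below O.val-split z≤n (<-trans t<k k<L) t<k)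

    A1≤z : A1 ≤ π z
    A1≤z = A1≤π (O.base≢inserted k<L) (Splits.above O.val-split z≤n k<L ≤-refl)

    z<x : toℕ z < toℕ x
    z<x = Splits.below O.pos-split z≤n k<L (n<1+n k)

    BO<z : ∀ {j} → j < k → toℕ (BO j) < toℕ z
    BO<z j<k = O.pos-asc z≤n j<k k<L

    large-impossible : A < π z → ⊥
    large-impossible A<z = σ-free (record
      { q≤L = O.q≤L ; pos-asc = O.pos-asc ; val-asc = BO-val-asc ; pos-split = O.pos-split
      ; val-split = record
          { below = λ _ _ t<k → subst (π (BO _) <_) (sym πx≡A) (<-trans (BO<A1 t<k) A1<A)
          ; above = λ _ t<L k≤t → subst (_< π (BO _)) (sym πx≡A)
                                    (<-≤-trans A<z (Ascending⇒≤ BO-val-asc z≤n k≤t t<L)) } })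

    module Straddled (BO<y : ∀ {j} → j < k → toℕ (BO j) < toℕ y)
                     (j : ℕ) (qᵐ≤j : qᵐ ≤ j) (1+j≡k : suc j ≡ k) where

      j<k : j < k
      j<k = subst (j <_) 1+j≡k (n<1+n j)

      j<L : j < L
      j<L = <-trans j<k k<L

      s≤j : ∀ {s} → s < k → s ≤ j
      s≤j s<k = ≤-pred (subst (_ <_) (sym 1+j≡k) s<k)

      u<y : toℕ (BO j) < toℕ y
      u<y = BO<y j<k

      y<v : toℕ y < toℕ (M j)
      y<v = Splits.above W.pos-split z≤n j<L qᵐ≤j

      v-below-u : π (M j) < π (BO j) → ⊥
      v-below-u πv<πu = low-inserted-impossible
          (Ascending-⊆ ≤-refl (<⇒≤ k<L) W.pos-asc) (Ascending-⊆ ≤-refl (<⇒≤ k<L) W.val-asc)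
          M<x M<πu (λ s<k Ms≡u → <-irrefl (cong π Ms≡u) (M<πu s<k)) (BO<A1 j<k)
          (inj₂ (j , 1+j≡k , <-trans u<y y<v))
        where
          M<πu : ∀ {s} → s < k → π (M s) < π (BO j)
          M<πu s<k = ≤-<-trans (Ascending⇒≤ W.val-asc z≤n (s≤j s<k) j<L) πv<πu

      u-below-v : π (BO j) < π (M j) → ⊥
      u-below-v πu<πv = low-prefix-impossible
          (Ascending-glue toℕ (Ascending-⊆ ≤-refl (<⇒≤ k<L) O.pos-asc) Ascending-singleton (λ _ s<k _ _ → BO<y s<k))
          (Ascending-glue π (Ascending-⊆ ≤-refl (<⇒≤ k<L) BO-val-asc) Ascending-singleton (λ _ s<k _ _ → BO<πy s<k))
          C<v (M<x j<k) C<πv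
          (subst (λ b → π (M j) < π b) (sym Ck≡y) (subst (π (M j) <_) (sym πy≡A1) (M<A1 j<k)))
          (subst (λ b → π b < A) (sym Ck≡y) (subst (_< A) (sym πy≡A1) A1<A))
        where
          C : ℕ → Fin n
          C = glue k BO (const y)
          Ck≡y : C k ≡ y
          Ck≡y = glue-≥ {U = BO} {V = const y} {j = k} ≤-refl
          BO<πy : ∀ {s} → s < k → π (BO s) < π y
          BO<πy s<k = subst (π (BO _) <_) (sym πy≡A1) (BO<A1 s<k)
          C<v : ∀ {s} → s < suc k → toℕ (C s) < toℕ (M j)
          C<v {s} s<1+k with s <? k
          ... | yes s<k = <-trans (BO<y s<k) y<v
          ... | no _    = y<v
          C<πv : ∀ {s} → s < k → π (C s) < π (M j)
          C<πv s<k = subst (λ b → π b < π (M j)) (sym (glue-< {U = BO} {V = const y} s<k))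
                       (≤-<-trans (Ascending⇒≤ BO-val-asc z≤n (s≤j s<k) j<L) πu<πv)

      impossible : ⊥
      impossible with <-cmp (π (BO j)) (π (M j))
      ... | tri< πu<πv _ _ = u-below-v πu<πv
      ... | tri≈ _ πu≡πv _ = <-irrefl (cong toℕ (π-injective πu≡πv)) (<-trans u<y y<v)
      ... | tri> _ _ πv<πu = v-below-u πv<πu

    straddled-impossible : toℕ y < toℕ x → (∀ {j} → j < k → toℕ (BO j) < toℕ y) → ⊥
    straddled-impossible y<x BO<y with <-cmp qᵐ k
    ... | tri< qᵐ<k _ _ = Straddled.impossible BO<y (pred k) (<⇒≤pred qᵐ<k)
                            (suc-pred k {{>-nonZero (≤-<-trans z≤n qᵐ<k)}})
    ... | tri≈ _ qᵐ≡k _ = qᵐ≢k qᵐ≡k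
    ... | tri> _ _ k<qᵐ = <-asym y<x (Splits.below W.pos-split z≤n k<L k<qᵐ)

    small-impossible : π z < A → ⊥
    small-impossible z<A with z ≟ᶠ y
    ... | yes z≡y = straddled-impossible (subst (λ b → toℕ b < toℕ x) z≡y z<x)
                                         (λ j<k → subst (λ b → toℕ (BO _) < toℕ b) z≡y (BO<z j<k))
    ... | no z≢y = from-insertion (insertionPoint L O.pos-asc BO≢y)
      where
        A1<z : A1 < π z
        A1<z = ≤∧≢⇒< A1≤z (λ A1≡z → z≢y (π-injective (trans (sym A1≡z) (sym πy≡A1))))
        A1<BO : ∀ {t} → k ≤ t → t < L → A1 < π (BO t)
        A1<BO k≤t t<L = <-≤-trans A1<z (Ascending⇒≤ BO-val-asc z≤n k≤t t<L)
        BO≢y : ∀ {t} → t < L → toℕ (BO t) ≢ toℕ y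
        BO≢y {t} t<L BOt≡y with t <? k | t ≟ k
        ... | yes t<k | _       = <-irrefl (trans (cong π (toℕ-injective BOt≡y)) πy≡A1) (BO<A1 t<k)
        ... | no _    | yes refl = z≢y (toℕ-injective BOt≡y)
        ... | no t≮k  | no t≢k  = <-irrefl (trans (sym πy≡A1) (cong π (sym (toℕ-injective BOt≡y))))
                                    (<-≤-trans A1<z (<⇒≤ (BO-val-asc z≤n (≤∧≢⇒< (≮⇒≥ t≮k) (≢-sym t≢k)) t<L)))
        from-insertion : ∃[ q ] q ≤ L × Splits (toℕ ∘ BO) 0 L q (toℕ y) → ⊥
        from-insertion (q , q≤L , pos-split) with q ≟ k
        ... | yes refl = straddled-impossible
                           (<-trans (Splits.above pos-split z≤n k<L ≤-refl) z<x)
                           (λ j<k → Splits.below pos-split z≤n (<-trans j<k k<L) j<k)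
        ... | no q≢k = <⇒≱ z<A (A-least q≢k (record
              { q≤L = q≤L ; pos-asc = O.pos-asc ; val-asc = BO-val-asc ; pos-split = pos-split
              ; val-split = record
                  { below = λ _ _ t<k → subst (π (BO _) <_) (sym πy≡A1) (BO<A1 t<k)
                  ; above = λ _ t<L k≤t → subst (_< π (BO _)) (sym πy≡A1) (A1<BO k≤t t<L) } }))

    impossible : ⊥
    impossible with <-cmp (π z) A
    ... | tri< z<A _ _ = small-impossible z<A
    ... | tri≈ _ z≡A _ = O.base≢inserted k<L (π-injective (trans z≡A (sym πx≡A)))
    ... | tri> _ _ A<z = large-impossible A<z

  module XInBase {BO : ℕ → Fin n} {wO : Fin n} (O : Shuffled π′ k L (suc k) BO wO)
                 {t₀ : ℕ} (t₀<L : t₀ < L) (BOt₀≡x : BO t₀ ≡ x) where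

    private module O = Shuffled O

    BO≢x : ∀ {t} → t < L → t ≢ t₀ → BO t ≢ x
    BO≢x t<L t≢t₀ BOt≡x = t≢t₀ (O.base-injective t<L t₀<L (trans BOt≡x (sym BOt₀≡x)))

    wO≢x : wO ≢ x
    wO≢x wO≡x = O.base≢inserted t₀<L (trans BOt₀≡x (sym wO≡x))

    BO≢x-below : ∀ {t} → t < t₀ → BO t ≢ x
    BO≢x-below t<t₀ = BO≢x (<-trans t<t₀ t₀<L) (λ t≡t₀ → <-irrefl t≡t₀ t<t₀)

    x-before : t₀ < k → ⊥
    x-before t₀<k = σ-free (record
      { q≤L       = k<L
      ; pos-asc   = Ascending-glue toℕ (Ascending-⊆ ≤-refl (<⇒≤ k<L) W.pos-asc) (Ascending-⊆ z≤n ≤-refl O.pos-asc)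
                      (λ _ s<k k≤t t<L → <-trans (M<x s<k) (x<BO k≤t t<L))
      ; val-asc   = Ascending-glue π (Ascending-⊆ ≤-refl (<⇒≤ k<L) W.val-asc)
                      (Ascending-reflect BO≢x-above (Ascending-⊆ z≤n ≤-refl O.val-asc))
                      (λ _ s<k k≤t t<L → <-≤-trans (M<A1 s<k) (A1≤BO k≤t t<L))
      ; pos-split = Splits-glue toℕ (Splits-below (n≤1+n k) (λ _ s<k → <-trans (M<x s<k) x<wO))
                                    (Splits-⊆ z≤n ≤-refl O.pos-split)
      ; val-split = Splits-glue π (Splits-below ≤-refl (λ _ s<k → <-≤-trans (M<A1 s<k) A1≤wO))
                                  (Splits-reflect BO≢x-above wO≢x (Splits-⊆ z≤n ≤-refl O.val-split)) })
      where
        BO≢x-above : ∀ {t} → k ≤ t → t < L → BO t ≢ x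
        BO≢x-above k≤t t<L = BO≢x t<L (λ t≡t₀ → <-irrefl (sym t≡t₀) (<-≤-trans t₀<k k≤t))
        x<BO : ∀ {t} → k ≤ t → t < L → toℕ x < toℕ (BO t)
        x<BO k≤t t<L = subst (λ b → toℕ b < toℕ (BO _)) BOt₀≡x (O.pos-asc z≤n (<-≤-trans t₀<k k≤t) t<L)
        A1≤BO : ∀ {t} → k ≤ t → t < L → A1 ≤ π (BO t)
        A1≤BO k≤t t<L = A1≤π (BO≢x-above k≤t t<L)
          (subst (λ b → π′ b < π′ (BO _)) BOt₀≡x (O.val-asc z≤n (<-≤-trans t₀<k k≤t) t<L))
        x<wO : toℕ x < toℕ wO
        x<wO = subst (λ b → toℕ b < toℕ wO) BOt₀≡x (Splits.below O.pos-split z≤n t₀<L (m<n⇒m<1+n t₀<k))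
        A1≤wO : A1 ≤ π wO
        A1≤wO = A1≤π wO≢x (subst (λ b → π′ b < π′ wO) BOt₀≡x (Splits.below O.val-split z≤n t₀<L t₀<k))

    x-at : t₀ ≡ k → ⊥
    x-at t₀≡k = low-inserted-impossible
      (Ascending-⊆ ≤-refl (<⇒≤ k<L) O.pos-asc)
      (Ascending-reflect (λ _ s<k → BO≢x-below (s<t₀ s<k)) (Ascending-⊆ ≤-refl (<⇒≤ k<L) O.val-asc))
      (λ s<k → subst (λ b → toℕ (BO _) < toℕ b) BOt₀≡x (O.pos-asc z≤n (s<t₀ s<k) t₀<L))
      (λ s<k → π-reflects (BO≢x-below (s<t₀ s<k)) wO≢x (Splits.below O.val-split z≤n (<-trans s<k k<L) s<k))
      (λ s<k → O.base≢inserted (<-trans s<k k<L))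
      (π<A1 (subst (λ b → π′ wO < π′ b) BOt₀≡x (Splits.above O.val-split z≤n t₀<L (≤-reflexive (sym t₀≡k)))))
      (inj₁ (subst (λ b → toℕ b < toℕ wO) BOt₀≡x
               (Splits.below O.pos-split z≤n t₀<L (s≤s (≤-reflexive t₀≡k)))))
      where
        s<t₀ : ∀ {s} → s < k → s < t₀
        s<t₀ s<k = subst (_ <_) (sym t₀≡k) s<k

    x-after : k < t₀ → ⊥
    x-after k<t₀ = low-prefix-impossible
      (Ascending-⊆ ≤-refl k<L O.pos-asc)
      (Ascending-reflect (λ _ s<1+k → BO≢x-below (<-≤-trans s<1+k k<t₀)) (Ascending-⊆ ≤-refl k<L O.val-asc))
      (λ s<1+k → Splits.below O.pos-split z≤n (<-≤-trans s<1+k k<L) s<1+k)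
      (subst (λ b → toℕ wO < toℕ b) BOt₀≡x (Splits.above O.pos-split z≤n t₀<L k<t₀))
      (λ s<k → π-reflects (BO≢x-below (<-trans s<k k<t₀)) wO≢x (Splits.below O.val-split z≤n (<-trans s<k k<L) s<k))
      (π-reflects wO≢x (BO≢x-below k<t₀) (Splits.above O.val-split z≤n k<L ≤-refl))
      (<-trans (π<A1 (subst (λ b → π′ (BO k) < π′ b) BOt₀≡x (O.val-asc z≤n k<t₀ t₀<L))) A1<A)

    impossible : ⊥
    impossible with <-cmp t₀ k
    ... | tri< t₀<k _ _ = x-before t₀<k
    ... | tri≈ _ t₀≡k _ = x-at t₀≡k
    ... | tri> _ _ k<t₀ = x-after k<t₀

  shift-σ-free : ∀ {BO wO} → ¬ Shuffled π′ k L (suc k) BO wO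
  shift-σ-free {BO} {wO} O with anyUpTo? (λ t → BO t ≟ᶠ x) L
  ... | yes (t₀ , t₀<L , BOt₀≡x) = XInBase.impossible O t₀<L BOt₀≡x
  ... | no x∉BO with wO ≟ᶠ x
  ...   | yes refl = XInserted.impossible O
  ...   | no wO≢x  = σ-free (Shuffled-reflect (λ t<L BOt≡x → x∉BO (_ , t<L , BOt≡x)) wO≢x O)

IsOccurrence-≗ : ∀ {k n} {ρ : Fin k → ℕ} {π π′ : Fin n → ℕ} {e} →
                 (∀ i → π′ i ≡ π i) → IsOccurrence ρ π′ e → IsOccurrence ρ π e
IsOccurrence-≗ {e = e} π′≗π (pos , val) = pos , λ i j →
  (λ lt → subst₂ _<_ (π′≗π (e i)) (π′≗π (e j)) (proj₁ (val i j) lt)) ,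
  (λ lt → proj₂ (val i j) (subst₂ _<_ (sym (π′≗π (e i))) (sym (π′≗π (e j))) lt))

IsOccurrence-≡ : ∀ {k n} {ρ : Fin k → ℕ} {π : Fin n → ℕ} {e} → IsOccurrence ρ π e →
                 ∀ i j → ρ i ≡ ρ j → π (e i) ≡ π (e j)
IsOccurrence-≡ {π = π} {e} (_ , val) i j ρi≡ρj with <-cmp (π (e i)) (π (e j))
... | tri< lt _ _ = ⊥-elim (<-irrefl ρi≡ρj (proj₂ (val i j) lt))
... | tri≈ _ eq _ = eq
... | tri> _ _ gt = ⊥-elim (<-irrefl (sym ρi≡ρj) (proj₂ (val j i) gt))

module PartialShuffle {n : ℕ} (π : Fin n → ℕ) (k b : ℕ) where

  L : ℕ
  L = suc k + b

  private
    m : ℕ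
    m = k + suc b
    m≡L : m ≡ L
    m≡L = +-suc k b

    toℕ-index : ∀ {t} → t ≤ L → toℕ (t mod suc m) ≡ t
    toℕ-index {t} t≤L = toℕ-mod (s≤s (subst (t ≤_) (sym m≡L) t≤L))

    ρ≡ : ∀ p i → insertPat (suc k) (suc b) p i ≡ shufflePattern k (toℕ p) (toℕ i)
    ρ≡ p i = insertPat≡ (suc k) (suc b) p i

    shufflePattern-base-k : ∀ q → shufflePattern k q (skip q k) ≡ suc (suc k)
    shufflePattern-base-k q = trans (insert-skip q (suc k) (remElem (suc k)) k) (remElem-≥ ≤-refl)

  Shuffled⇒RolePair : ∀ {q B w} → Shuffled π k L q B w → q ≢ k → RolePair (suc (suc k)) b π (π (B k)) (π w)
  Shuffled⇒RolePair {q} {B} {w} S q≢k =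
    p , q≢k ∘ trans (sym toℕp≡q) , insert q w B ∘ toℕ ,
    Shuffled⇒IsOccurrence S m≡L _ (λ i → trans (ρ≡ p i) (cong (λ q → shufflePattern k q (toℕ i)) toℕp≡q)) ,
    j , p , ρj≡a , ρp≡a-1 , πj≡ , πp≡
    where
      p = q mod suc m
      toℕp≡q = toℕ-index (Shuffled.q≤L S)
      j = skip q k mod suc m
      toℕj≡ : toℕ j ≡ skip q k
      toℕj≡ = toℕ-index (≤-trans (skip-≤ q k) k<L)
        where k<L = s≤s (m≤m+n k b)
      ρj≡a = trans (ρ≡ p j) (trans (cong₂ (shufflePattern k) toℕp≡q toℕj≡) (shufflePattern-base-k q))
      ρp≡a-1 = trans (ρ≡ p p) (insert-at (toℕ p) (suc k) (remElem (suc k)))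
      πj≡ = cong π (trans (cong (insert q w B) toℕj≡) (insert-skip q w B k))
      πp≡ = cong π (trans (cong (insert q w B) toℕp≡q) (insert-at q w B))

  RolePair⇒Shuffled : ∀ {u v} → RolePair (suc (suc k)) b π u v →
                      ∃[ q ] ∃[ B ] ∃[ w ] q ≢ k × Shuffled π k L q B w × π (B k) ≡ u × π w ≡ v
  RolePair⇒Shuffled (p , p≢k , e , occ , j , j′ , ρj≡a , ρj′≡a-1 , πj≡u , πj′≡v) =
    toℕ p , _ , _ , p≢k , S ,
    trans (IsOccurrence-≡ {π = π} occ i₀ j (trans (ρ≡ p i₀) (trans ρi₀≡a (sym ρj≡a)))) πj≡u ,
    trans (cong (π ∘ e) (toℕ-injective (toℕ-index q≤L)))
          (trans (IsOccurrence-≡ {π = π} occ p j′ (trans ρp≡a-1 (sym ρj′≡a-1))) πj′≡v)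
    where
      q≤L : toℕ p ≤ L
      q≤L = subst (toℕ p ≤_) m≡L (≤-pred (toℕ<n p))
      S = IsOccurrence⇒Shuffled occ m≡L q≤L (ρ≡ p)
      i₀ = skip (toℕ p) k mod suc m
      ρi₀≡a : shufflePattern k (toℕ p) (toℕ i₀) ≡ suc (suc k)
      ρi₀≡a = trans (cong (shufflePattern k (toℕ p)) (toℕ-index (≤-trans (skip-≤ (toℕ p) k) (s≤s (m≤m+n k b)))))
                    (shufflePattern-base-k (toℕ p))
      ρp≡a-1 : insertPat (suc k) (suc b) p p ≡ suc k
      ρp≡a-1 = trans (ρ≡ p p) (insert-at (toℕ p) (suc k) (remElem (suc k)))

  Shuffled⇒σ-occurrence : ∀ {B w} → Shuffled π k L (suc k) B w → Contains (σ (suc (suc k)) b) π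
  Shuffled⇒σ-occurrence S = _ , Shuffled⇒IsOccurrence S refl _ (σ≡ k b)

  σ-occurrence⇒Shuffled : ∀ {e} → IsOccurrence (σ (suc (suc k)) b) π e →
                          Shuffled π k L (suc k) (entryAt e ∘ skip (suc k)) (entryAt e (suc k))
  σ-occurrence⇒Shuffled occ = IsOccurrence⇒Shuffled occ refl (s≤s (m≤m+n k b)) (σ≡ k b)

lemma2p7 : (a b : ℕ) → 2 ≤ a → (n : ℕ) → (π : Fin n → ℕ) → IsPerm n π →
           Avoids (σ a b) π → (π' : Fin n → ℕ) → IsS a b π π' →
           Avoids (σ a b) π'
lemma2p7 a b _ n π _ avoid π' (inj₁ (_ , π'≗π)) (e , occ) = avoid (e , IsOccurrence-≗ π'≗π occ)
lemma2p7 (suc (suc k)) b (s≤s (s≤s z≤n)) n π (_ , π-injective) avoid π'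
         (inj₂ (A , A1 , A-least , A1-least , π'≗)) (e , occ) =
  let _ , _ , _ , q≢k , W , πx≡A , πy≡A1 = RolePair⇒Shuffled (proj₁ A1-least) in
  ShiftAvoidsσ.shift-σ-free π (π-injective _ _) k L (s≤s (m≤m+n k b))
    (avoid ∘ Shuffled⇒σ-occurrence) A A1
    (λ q≢k S → proj₂ A-least _ (_ , Shuffled⇒RolePair S q≢k))
    (λ q≢k S πBk≡A → proj₂ A1-least _ (subst (λ u → RolePair (suc (suc k)) b π u _) πBk≡A (Shuffled⇒RolePair S q≢k)))
    q≢k W πx≡A πy≡A1
    (PartialShuffle.σ-occurrence⇒Shuffled (shiftVal A A1 ∘ π) k b (IsOccurrence-≗ π'≗ occ))
  where open PartialShuffle π k b
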